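{- Let $(E,S,P)$ be a pmf-structure (as defined in the context) and let $x,y\in E$. Call $x$ and $y$ independent if $P(x\wedge y)=P(x)\cdot P(y)$. Then $x$ and $y$ are independent if and only if $P(x\mid y)=P(x)\cdot P(y\mid y)$, and also if and only if $P(y\mid x)=P(y)\cdot P(x\mid x)$.
   Context: Two-sorted signature: an event sort $E$ with binary operations $\vee,\wedge$, unary $\neg$, constants $\top,\bot$; a stalk sort $S$ with binary $+,\cdot$, unary $-$ (additive inverse), unary ${}^{ -1}$ (inverse), unary $\mathbf{s}$ (sign), constants $0,1$; and a function $P:E\to S$. Abbreviations: $p-q=p+(-q)$, $1_p=p\cdot p^{ -1}$, $0_p=1-1_p$, $\frac{p}{q}=p\cdot q^{ -1}$, $P(x\mid y)=\frac{P(x\wedge y)}{P(y)}$. A pmf-structure is a structure for this signature satisfying, for all values of the variables, the following equations. Boolean algebra: $(x\vee y)\wedge y=y$; $(x\wedge y)\vee y=y$; $x\wedge(y\vee z)=(y\wedge x)\vee(z\wedge x)$; $x\vee(y\wedge z)=(y\vee x)\wedge(z\vee x)$; $x\wedge\neg x=\bot$; $x\vee\neg x=\top$. Meadow: $(x+y)+z=x+(y+z)$; $x+y=y+x$; $x+0=x$; $x+(-x)=0$; $(x\cdot y)\cdot z=x\cdot(y\cdot z)$; $x\cdot y=y\cdot x$; $1\cdot x=x$; $x\cdot(y+z)=x\cdot y+x\cdot z$; $(x^{ -1})^{ -1}=x$; $x\cdot(x\cdot x^{ -1})=x$. Sign: $\mathbf{s}(1_x)=1_x$; $\mathbf{s}(0_x)=0_x$;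 $\mathbf{s}(-1)=-1$; $\mathbf{s}(x^{ -1})=\mathbf{s}(x)$; $\mathbf{s}(x\cdot y)=\mathbf{s}(x)\cdot\mathbf{s}(y)$; $0_{\mathbf{s}(x)-\mathbf{s}(y)}\cdot(\mathbf{s}(x+y)-\mathbf{s}(x))=0$. Pmf (with $x,y$ events): $P(\top)=1$; $P(\bot)=0$; $\mathbf{s}(\mathbf{s}(P(x))+1)=1$; $P(x\vee y)=P(x)+P(y)-P(x\wedge y)$; $P(x\wedge y)\cdot P(y)\cdot P(y)^{ -1}=P(x\wedge y)$. -}

module Defs where

open import Level using (Level; suc; _⊔_)
open import Relation.Binary.PropositionalEquality using (_≡_)

record PmfStructure (e s : Level) : Set (suc (e ⊔ s)) where
  infixr 6 _∨_
  infixr 7 _∧_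
  infixl 6 _+_ _-_
  infixl 7 _·_
  field
    E : Set e
    S : Set s
    _∨_ _∧_ : E → E → E
    ¬_ : E → E
    ⊤ ⊥ : E
    _+_ _·_ : S → S → S
    -_ : S → S
    _⁻¹ : S → S
    sgn : S → S
    0# 1# : S
    P : E → S

  _-_ : S → S → S
  p - q = p + (- q)

  1[_] : S → S
  1[ p ] = p · (p ⁻¹)

  0[_] : S → S
  0[ p ] = 1# - 1[ p ]

  _÷_ : S → S → S
  p ÷ q = p · (q ⁻¹)

  P[_∣_] : E → E → S
  P[ x ∣ y ] = P (x ∧ y) ÷ P y

  field
    ba-absorb₁ : ∀ x y → (x ∨ y) ∧ y ≡ y
    ba-absorb₂ : ∀ x y → (x ∧ y) ∨ y ≡ y
    ba-distrib₁ : ∀ x y z → x ∧ (y ∨ z) ≡ (y ∧ x) ∨ (z ∧ x)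
    ba-distrib₂ : ∀ x y z → x ∨ (y ∧ z) ≡ (y ∨ x) ∧ (z ∨ x)
    ba-compl₁ : ∀ x → x ∧ (¬ x) ≡ ⊥
    ba-compl₂ : ∀ x → x ∨ (¬ x) ≡ ⊤
    +-assoc : ∀ x y z → (x + y) + z ≡ x + (y + z)
    +-comm : ∀ x y → x + y ≡ y + x
    +-identityʳ : ∀ x → x + 0# ≡ x
    +-inverseʳ : ∀ x → x + (- x) ≡ 0#
    ·-assoc : ∀ x y z → (x · y) · z ≡ x · (y · z)
    ·-comm : ∀ x y → x · y ≡ y · x
    ·-identityˡ : ∀ x → 1# · x ≡ x
    distrib : ∀ x y z → x · (y + z) ≡ x · y + x · z
    inv-involutive : ∀ x → (x ⁻¹) ⁻¹ ≡ x
    ril : ∀ x → x · (x · (x ⁻¹)) ≡ x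
    sgn-1 : ∀ x → sgn (1[ x ]) ≡ 1[ x ]
    sgn-0 : ∀ x → sgn (0[ x ]) ≡ 0[ x ]
    sgn-neg1 : sgn (- 1#) ≡ - 1#
    sgn-inv : ∀ x → sgn (x ⁻¹) ≡ sgn x
    sgn-mul : ∀ x y → sgn (x · y) ≡ sgn x · sgn y
    sgn-add : ∀ x y → 0[ sgn x - sgn y ] · (sgn (x + y) - sgn x) ≡ 0#
    P-⊤ : P ⊤ ≡ 1#
    P-⊥ : P ⊥ ≡ 0#
    P-nonneg : ∀ x → sgn (sgn (P x) + 1#) ≡ 1#
    P-additive : ∀ x y → P (x ∨ y) ≡ P x + P y - P (x ∧ y)
    P-cond : ∀ x y → P (x ∧ y) · P y · (P y ⁻¹) ≡ P (x ∧ y)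

  Independent : E → E → Set s
  Independent x y = P (x ∧ y) ≡ P x · P y

-- Since P(x ∧ y) is supported where P(y) is (P-cond), dividing by P(y) loses
-- no information: P(x ∧ y) = c · P(y) holds exactly when
-- P(x ∧ y) / P(y) = c · 1_{P(y)}, and 1_{P(y)} = P(y ∣ y) because y ∧ y = y.
-- The second equivalence is the first with x and y swapped, as independence
-- is symmetric.
module Submission where

open import Defs
open import Level using (Level)
open import Data.Product using (_×_; _,_)
open import Function.Bundles using (_⇔_; mk⇔)
open import Function.Properties.Equivalence using () renaming (trans to ⇔-trans)
open import Relation.Binary.PropositionalEquality
  using (_≡_; sym; trans; cong; subst; module ≡-Reasoning)

module PmfProperties {e s : Level} (M : PmfStructure e s) where
  open PmfStructure M
  open ≡-Reasoning

  ∧-idem : ∀ x → x ∧ x ≡ x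
  ∧-idem x = trans (cong (_∧ x) (sym (ba-absorb₂ x x))) (ba-absorb₁ (x ∧ x) x)

  ∨-idem : ∀ x → x ∨ x ≡ x
  ∨-idem x = trans (cong (_∨ x) (sym (ba-absorb₁ x x))) (ba-absorb₂ (x ∨ x) x)

  ∧-comm : ∀ x y → x ∧ y ≡ y ∧ x
  ∧-comm x y = begin
    x ∧ y              ≡⟨ cong (x ∧_) (sym (∨-idem y)) ⟩
    x ∧ (y ∨ y)        ≡⟨ ba-distrib₁ x y y ⟩
    (y ∧ x) ∨ (y ∧ x)  ≡⟨ ∨-idem (y ∧ x) ⟩
    y ∧ x              ∎

  ÷-·-cancel : ∀ {a b} → a · b · b ⁻¹ ≡ a → a ÷ b · b ≡ a
  ÷-·-cancel {a} {b} supported = begin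
    a · b ⁻¹ · b      ≡⟨ ·-assoc a (b ⁻¹) b ⟩
    a · (b ⁻¹ · b)    ≡⟨ cong (a ·_) (·-comm (b ⁻¹) b) ⟩
    a · (b · b ⁻¹)    ≡⟨ ·-assoc a b (b ⁻¹) ⟨
    a · b · b ⁻¹      ≡⟨ supported ⟩
    a                 ∎

  ·-1[]-absorb : ∀ c b → c · 1[ b ] · b ≡ c · b
  ·-1[]-absorb c b = begin
    c · (b · b ⁻¹) · b  ≡⟨ ·-assoc c (b · b ⁻¹) b ⟩
    c · (b · b ⁻¹ · b)  ≡⟨ cong (c ·_) (·-comm (b · b ⁻¹) b) ⟩
    c · (b · 1[ b ])    ≡⟨ cong (c ·_) (ril b) ⟩
    c · b               ∎

  ≡·⇔÷≡·1[] : ∀ {a b c} → a · b · b ⁻¹ ≡ a → (a ≡ c · b) ⇔ (a ÷ b ≡ c · 1[ b ])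
  ≡·⇔÷≡·1[] {a} {b} {c} supported = mk⇔ divide multiply
    where
    divide : a ≡ c · b → a ÷ b ≡ c · 1[ b ]
    divide a≡cb = trans (cong (_÷ b) a≡cb) (·-assoc c b (b ⁻¹))

    multiply : a ÷ b ≡ c · 1[ b ] → a ≡ c · b
    multiply a÷b≡c1b = begin
      a              ≡⟨ ÷-·-cancel supported ⟨
      a ÷ b · b      ≡⟨ cong (_· b) a÷b≡c1b ⟩
      c · 1[ b ] · b ≡⟨ ·-1[]-absorb c b ⟩
      c · b          ∎

  P[x∣x]≡1[Px] : ∀ x → P[ x ∣ x ] ≡ 1[ P x ]
  P[x∣x]≡1[Px] x = cong (λ z → P z ÷ P x) (∧-idem x)

  Independent-sym : ∀ {x y} → Independent x y → Independent y x
  Independent-sym {x} {y} independent = begin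
    P (y ∧ x)  ≡⟨ cong P (∧-comm y x) ⟩
    P (x ∧ y)  ≡⟨ independent ⟩
    P x · P y  ≡⟨ ·-comm (P x) (P y) ⟩
    P y · P x  ∎

  Independent⇔P[∣]≡·P[∣] : ∀ x y → Independent x y ⇔ (P[ x ∣ y ] ≡ P x · P[ y ∣ y ])
  Independent⇔P[∣]≡·P[∣] x y =
    subst (λ t → Independent x y ⇔ (P[ x ∣ y ] ≡ P x · t))
          (sym (P[x∣x]≡1[Px] y))
          (≡·⇔÷≡·1[] (P-cond x y))

theorem2 : ∀ {e s : Level} (M : PmfStructure e s) (x y : PmfStructure.E M) →
    let open PmfStructure M in
      (Independent x y ⇔ (P[ x ∣ y ] ≡ P x · P[ y ∣ y ]))
      × (Independent x y ⇔ (P[ y ∣ x ] ≡ P y · P[ x ∣ x ]))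
theorem2 M x y =
    Independent⇔P[∣]≡·P[∣] x y
  , ⇔-trans (mk⇔ Independent-sym Independent-sym) (Independent⇔P[∣]≡·P[∣] y x)
  where open PmfProperties M
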